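{- Let $m,n\ge 1$. If $C$ is any maximal configuration on the $m\times n$ grid, then $|C|\le E_{m,n}\le R_{m,n}$, where for fixed $n$ the sequence $(R_{k,n})_{k\ge 0}$ is defined by $R_{0,n}=0$, $R_{1,n}=n$, and $$R_{k,n}=R_{k-1,n}+n-\left\lfloor\frac{R_{k-1,n}-R_{k-2,n}}{3}\right\rfloor\quad\text{for } k\ge 2.$$
   Context: The $m\times n$ grid is $[m]\times[n]=\{(i,j):1\le i\le m,\ 1\le j\le n\}$; $(i,j)$ is the lot in row $i$ and column $j$, rows counted from the north (row $m$ southernmost) and columns from the west. A configuration is a subset $C\subseteq[m]\times[n]$ (the occupied lots); $|C|$ is its occupancy. A house at $(i,j)\in C$ is blocked from sunlight if $(i,j+1)$, $(i,j-1)$, $(i+1,j)$ all lie in the grid and are all occupied (lots outside the grid never obstruct sunlight). A configuration is permissible if no house in it is blocked; it is maximal if it is permissible and no permissible configuration strictly contains it. $E_{m,n}$ denotes the maximum of $|C|$ over all maximal configurations $C$ on the $m\times n$ grid. -}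

module Defs where

open import Data.Nat using (ℕ; zero; suc; _+_; _∸_; _≤_; _/_)
open import Data.Bool using (Bool; true; false)
open import Data.Fin using (Fin; toℕ)
open import Data.Product using (Σ; _×_)
open import Relation.Nullary using (¬_)
open import Relation.Binary.PropositionalEquality using (_≡_)

-- Rows i : Fin m are 0-indexed from the north (toℕ i = paper's row − 1),
-- columns j : Fin n are 0-indexed from the west.
Config : ℕ → ℕ → Set
Config m n = Fin m → Fin n → Bool

sumFin : (k : ℕ) → (Fin k → ℕ) → ℕ
sumFin zero    f = 0
sumFin (suc k) f = f Fin.zero + sumFin k (λ x → f (Fin.suc x))

b2n : Bool → ℕ
b2n true  = 1
b2n false = 0

occupancy : ∀ {m n} → Config m n → ℕ
occupancy {m} {n} C = sumFin m (λ i → sumFin n (λ j → b2n (C i j)))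

Blocked : ∀ {m n} → Config m n → Fin m → Fin n → Set
Blocked {m} {n} C i j =
  C i j ≡ true
  × Σ (Fin n) (λ e → toℕ e ≡ suc (toℕ j) × C i e ≡ true)
  × Σ (Fin n) (λ w → suc (toℕ w) ≡ toℕ j × C i w ≡ true)
  × Σ (Fin m) (λ s → toℕ s ≡ suc (toℕ i) × C s j ≡ true)

Permissible : ∀ {m n} → Config m n → Set
Permissible C = ∀ i j → ¬ Blocked C i j

_⊆C_ : ∀ {m n} → Config m n → Config m n → Set
C ⊆C D = ∀ i j → C i j ≡ true → D i j ≡ true

Maximal : ∀ {m n} → Config m n → Set
Maximal {m} {n} C =
  Permissible C × (∀ (D : Config m n) → Permissible D → C ⊆C D → D ⊆C C)

IsE : ℕ → ℕ → ℕ → Set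
IsE m n e =
  Σ (Config m n) (λ C → Maximal C × occupancy C ≡ e)
  × (∀ (C : Config m n) → Maximal C → occupancy C ≤ e)

-- R n k = R_{k,n}.
R : ℕ → ℕ → ℕ
R n zero = 0
R n (suc zero) = n
R n (suc (suc k)) = R n (suc k) + n ∸ ((R n (suc k) ∸ R n k) / 3)

{-# OPTIONS --safe #-}
-- A row with c₀ houses above a row with c₁ houses satisfies 3c₀ + c₁ ≤ 3n + 2: score each
-- column 3 for a house in the upper row and 1 for a house in the lower row. A column scoring
-- 4 holds a house that is not blocked, so a horizontal neighbour scores at most 1; scanning
-- from the west, the excess above 3 per column therefore never exceeds 2. Hence
-- c₀ + ⌊c₁/3⌋ ≤ n. Deleting the northernmost row keeps a configuration permissible, so
-- induction on the number of rows bounds the rest by R_{m-1,n} and R_{m-2,n}, and the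
-- recurrence for R absorbs the two rows. E_{m,n} is attained by a maximal, hence
-- permissible, configuration.
module Submission where

open import Defs
open import Data.Nat using (ℕ; zero; suc; _+_; _*_; _∸_; _≤_; _/_; NonZero; z≤n; s≤s)
open import Data.Nat.Properties
open import Data.Nat.DivMod using (+-distrib-/-∣ʳ; m*n/n≡m; /-monoˡ-≤)
open import Data.Nat.Divisibility using (divides-refl)
open import Data.Nat.Tactic.RingSolver using (solve-∀)
open import Data.Bool using (Bool; true; false)
open import Data.Fin using (Fin; toℕ)
open import Data.List using (List; []; _∷_; length; tabulate)
open import Data.List.Properties using (length-tabulate)
open import Data.Unit using (⊤; tt)
open import Data.Empty using (⊥-elim)
open import Data.Product using (_×_; _,_; proj₁; proj₂)
open import Relation.Nullary using (¬_)
open import Relation.Binary.PropositionalEquality using (_≡_; refl; cong; subst; subst₂; module ≡-Reasoning)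

b2n≤1 : ∀ b → b2n b ≤ 1
b2n≤1 true  = s≤s z≤n
b2n≤1 false = z≤n

[m+n*o]/o≡m/o+n : ∀ m n o .{{_ : NonZero o}} → (m + n * o) / o ≡ m / o + n
[m+n*o]/o≡m/o+n m n o = begin
  (m + n * o) / o    ≡⟨ +-distrib-/-∣ʳ m (divides-refl n) ⟩
  m / o + n * o / o  ≡⟨ cong (m / o +_) (m*n/n≡m n o) ⟩
  m / o + n          ∎
  where open ≡-Reasoning

m≤n⇒n/o+m≤n+m/o : ∀ {m n} o .{{_ : NonZero o}} → m ≤ n → n / o + m ≤ n + m / o
m≤n⇒n/o+m≤n+m/o {m} {n} o m≤n = begin
  n / o + m              ≡⟨ cong (λ k → k / o + m) (m+[n∸m]≡n m≤n) ⟨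
  (m + d) / o + m        ≤⟨ +-monoˡ-≤ m (/-monoˡ-≤ o (+-monoʳ-≤ m (m≤m*n d o))) ⟩
  (m + d * o) / o + m    ≡⟨ cong (_+ m) ([m+n*o]/o≡m/o+n m d o) ⟩
  m / o + d + m          ≡⟨ shuffle (m / o) d m ⟩
  m + d + m / o          ≡⟨ cong (_+ m / o) (m+[n∸m]≡n m≤n) ⟩
  n + m / o              ∎
  where
  open ≤-Reasoning
  d : ℕ
  d = n ∸ m
  shuffle : ∀ a b c → a + b + c ≡ c + b + a
  shuffle = solve-∀

-- c₀, c₁ count the two northernmost rows, s the rest; r₁, r₀ bound the configurations
-- without the first row and without the first two rows.
recurrence-step : ∀ {c₀ c₁ s r₀ r₁ n} o .{{_ : NonZero o}} →
  c₀ + c₁ / o ≤ n → c₁ + s ≤ r₁ → s ≤ r₀ →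
  c₀ + (c₁ + s) ≤ r₁ + n ∸ (r₁ ∸ r₀) / o
recurrence-step {c₀} {c₁} {s} {r₀} {r₁} {n} o top c₁+s≤r₁ s≤r₀ =
  m+n≤o⇒m≤o∸n (c₀ + (c₁ + s)) (begin
    c₀ + (c₁ + s) + (r₁ ∸ r₀) / o  ≤⟨ +-monoʳ-≤ (c₀ + (c₁ + s)) (/-monoˡ-≤ o (∸-monoʳ-≤ r₁ s≤r₀)) ⟩
    c₀ + (c₁ + s) + d / o          ≡⟨ shuffle c₀ c₁ s (d / o) ⟩
    s + (c₀ + (d / o + c₁))        ≤⟨ +-monoʳ-≤ s (+-monoʳ-≤ c₀ (m≤n⇒n/o+m≤n+m/o o c₁≤d)) ⟩
    s + (c₀ + (d + c₁ / o))        ≡⟨ shuffle′ s c₀ d (c₁ / o) ⟩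
    s + d + (c₀ + c₁ / o)          ≤⟨ +-mono-≤ (≤-reflexive (m+[n∸m]≡n (m+n≤o⇒n≤o c₁ c₁+s≤r₁))) top ⟩
    r₁ + n                         ∎)
  where
  open ≤-Reasoning
  d : ℕ
  d = r₁ ∸ s
  c₁≤d : c₁ ≤ d
  c₁≤d = m+n≤o⇒m≤o∸n c₁ c₁+s≤r₁
  shuffle : ∀ a b c e → a + (b + c) + e ≡ c + (a + (e + b))
  shuffle = solve-∀
  shuffle′ : ∀ a b c e → a + (b + (c + e)) ≡ a + c + (b + e)
  shuffle′ = solve-∀

-- A column holds the house of a row (first) and the house south of it (second).
Column : Set
Column = Bool × Bool

weight : List Column → ℕ
weight []             = 0
weight ((t , b) ∷ cs) = b2n t * 3 + b2n b + weight cs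

Blocks : Column → Column → Column → Set
Blocks x y z = proj₁ x ≡ true × proj₁ y ≡ true × proj₂ y ≡ true × proj₁ z ≡ true

Unblocked : List Column → Set
Unblocked (x ∷ y ∷ z ∷ cs) = ¬ Blocks x y z × Unblocked (y ∷ z ∷ cs)
Unblocked _                = ⊤

Unblocked-tail : ∀ c cs → Unblocked (c ∷ cs) → Unblocked cs
Unblocked-tail c []           u = tt
Unblocked-tail c (_ ∷ [])     u = tt
Unblocked-tail c (_ ∷ _ ∷ cs) u = proj₂ u

-- After a column whose upper house is present, the slack drops from 2 to 1.
mutual
  weight-bound : ∀ cs → Unblocked cs → weight cs ≤ 2 + length cs * 3
  weight-bound []                     u = z≤n
  weight-bound ((false , true) ∷ cs)  u = s≤s (m≤n⇒m≤o+n 2 (weight-bound cs (Unblocked-tail _ cs u)))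
  weight-bound ((false , false) ∷ cs) u = m≤n⇒m≤o+n 3 (weight-bound cs (Unblocked-tail _ cs u))
  weight-bound ((true , b) ∷ cs)      u =
    s≤s (s≤s (s≤s (+-mono-≤ (b2n≤1 b) (weight-bound-after-house b cs u))))

  weight-bound-after-house : ∀ b cs → Unblocked ((true , b) ∷ cs) → weight cs ≤ 1 + length cs * 3
  weight-bound-after-house _ [] u = z≤n
  weight-bound-after-house _ ((false , b) ∷ cs) u =
    m≤n⇒m≤o+n 1 (+-mono-≤ (b2n≤1 b) (weight-bound cs (Unblocked-tail _ cs (Unblocked-tail _ _ u))))
  weight-bound-after-house _ ((true , b) ∷ []) u = s≤s (s≤s (s≤s (+-mono-≤ (b2n≤1 b) z≤n)))
  weight-bound-after-house b₀ ((true , b) ∷ (false , b′) ∷ cs) u =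
    s≤s (s≤s (s≤s (+-mono-≤ (b2n≤1 b) (+-mono-≤ (b2n≤1 b′)
      (weight-bound cs (Unblocked-tail _ cs (Unblocked-tail _ _ (Unblocked-tail (true , b₀) _ u))))))))
  weight-bound-after-house _ ((true , true) ∷ (true , _) ∷ _) u = ⊥-elim (proj₁ u (refl , refl , refl , refl))
  weight-bound-after-house _ ((true , false) ∷ (true , b′) ∷ cs) u =
    s≤s (s≤s (s≤s (weight-bound-after-house false ((true , b′) ∷ cs) (proj₂ u))))

count : ∀ {n} → (Fin n → Bool) → ℕ
count {n} f = sumFin n (λ j → b2n (f j))

count≤n : ∀ {n} (f : Fin n → Bool) → count f ≤ n
count≤n {zero}  f = z≤n
count≤n {suc n} f = +-mono-≤ (b2n≤1 (f Fin.zero)) (count≤n (λ j → f (Fin.suc j)))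

columns : ∀ {n} → (Fin n → Bool) → (Fin n → Bool) → List Column
columns r s = tabulate (λ j → r j , s j)

weight-columns : ∀ {n} (r s : Fin n → Bool) → weight (columns r s) ≡ count r * 3 + count s
weight-columns {zero}  r s = refl
weight-columns {suc n} r s = begin
  b2n (r Fin.zero) * 3 + b2n (s Fin.zero) + weight (columns r′ s′)
    ≡⟨ cong (b2n (r Fin.zero) * 3 + b2n (s Fin.zero) +_) (weight-columns r′ s′) ⟩
  b2n (r Fin.zero) * 3 + b2n (s Fin.zero) + (count r′ * 3 + count s′)
    ≡⟨ interchange (b2n (r Fin.zero)) (b2n (s Fin.zero)) (count r′) (count s′) ⟩
  count r * 3 + count s ∎
  where
  open ≡-Reasoning
  r′ s′ : Fin n → Bool
  r′ j = r (Fin.suc j)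
  s′ j = s (Fin.suc j)
  interchange : ∀ a b c d → a * 3 + b + (c * 3 + d) ≡ (a + c) * 3 + (b + d)
  interchange = solve-∀

UnblockedRow : ∀ {n} → (Fin n → Bool) → (Fin n → Bool) → Set
UnblockedRow {n} r s = ∀ (j e w : Fin n) → toℕ e ≡ suc (toℕ j) → suc (toℕ w) ≡ toℕ j →
  ¬ (r w ≡ true × r j ≡ true × s j ≡ true × r e ≡ true)

Unblocked-columns : ∀ {n} (r s : Fin n → Bool) → UnblockedRow r s → Unblocked (columns r s)
Unblocked-columns {0}                 r s u = tt
Unblocked-columns {1}                 r s u = tt
Unblocked-columns {2}                 r s u = tt
Unblocked-columns {suc (suc (suc n))} r s u =
  u (Fin.suc Fin.zero) (Fin.suc (Fin.suc Fin.zero)) Fin.zero refl refl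
  , Unblocked-columns (λ j → r (Fin.suc j)) (λ j → s (Fin.suc j))
      (λ j e w e≡j+1 w+1≡j → u (Fin.suc j) (Fin.suc e) (Fin.suc w) (cong suc e≡j+1) (cong suc w+1≡j))

count+count/3≤n : ∀ {n} (r s : Fin n → Bool) → UnblockedRow r s → count r + count s / 3 ≤ n
count+count/3≤n {n} r s u = begin
  count r + count s / 3       ≡⟨ +-comm (count r) (count s / 3) ⟩
  count s / 3 + count r       ≡⟨ [m+n*o]/o≡m/o+n (count s) (count r) 3 ⟨
  (count s + count r * 3) / 3 ≤⟨ /-monoˡ-≤ 3 (≤-trans (≤-reflexive (+-comm (count s) (count r * 3))) weight≤) ⟩
  (2 + n * 3) / 3             ≡⟨ [m+n*o]/o≡m/o+n 2 n 3 ⟩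
  n                           ∎
  where
  open ≤-Reasoning
  weight≤ : count r * 3 + count s ≤ 2 + n * 3
  weight≤ = subst₂ (λ w l → w ≤ 2 + l * 3) (weight-columns r s) (length-tabulate (λ j → r j , s j))
    (weight-bound (columns r s) (Unblocked-columns r s u))

dropRow : ∀ {m n} → Config (suc m) n → Config m n
dropRow C i = C (Fin.suc i)

Permissible-dropRow : ∀ {m n} (C : Config (suc m) n) → Permissible C → Permissible (dropRow C)
Permissible-dropRow C p i j (here , east , west , (s , s≡i+1 , south)) =
  p (Fin.suc i) j (here , east , west , (Fin.suc s , cong suc s≡i+1 , south))

Permissible⇒UnblockedRow : ∀ {m n} (C : Config (suc (suc m)) n) → Permissible C →
  UnblockedRow (C Fin.zero) (C (Fin.suc Fin.zero))
Permissible⇒UnblockedRow C p j e w e≡j+1 w+1≡j (west , here , south , east) =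
  p Fin.zero j (here , (e , e≡j+1 , east) , (w , w+1≡j , west) , (Fin.suc Fin.zero , refl , south))

occupancy≤R : ∀ {m n} (C : Config m n) → Permissible C → occupancy C ≤ R n m
occupancy≤R {zero}            C p = z≤n
occupancy≤R {suc zero}        C p = ≤-trans (≤-reflexive (+-identityʳ _)) (count≤n (C Fin.zero))
occupancy≤R {suc (suc m)} {n} C p =
  recurrence-step 3
    (count+count/3≤n (C Fin.zero) (C (Fin.suc Fin.zero)) (Permissible⇒UnblockedRow C p))
    (occupancy≤R C′ p′)
    (occupancy≤R (dropRow C′) (Permissible-dropRow C′ p′))
  where
  C′ : Config (suc m) n
  C′ = dropRow C
  p′ : Permissible C′
  p′ = Permissible-dropRow C p

theorem4p12 : (m n : ℕ) → 1 ≤ m → 1 ≤ n →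
    (e : ℕ) → IsE m n e →
    (C : Config m n) → Maximal C →
    (occupancy C ≤ e) × (e ≤ R n m)
theorem4p12 m n _ _ e ((C* , (permissible , _) , occupancy≡e) , e-bounds) C maximal =
  e-bounds C maximal , subst (_≤ R n m) occupancy≡e (occupancy≤R C* permissible)
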